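{- Let $X\subseteq\omega$ and let $\{R_e\}_{e\in\omega}$ be a collection of uniformly $X$-computable infinite subsets of $\omega$. Then there is an intrinsically small set $A\leq_T \emptyset'\oplus X$ such that $A\cap R_e\neq\emptyset$ for every $e\in\omega$.
   Context: For $A\subseteq\omega$ and $n\geq 1$, $\rho_n(A)=|A\cap\{0,\dots,n-1\}|/n$; the upper density is $\overline{\rho}(A)=\limsup_n\rho_n(A)$, the lower density is $\underline{\rho}(A)=\liminf_n\rho_n(A)$, and if they agree the common value is the density $\rho(A)$. The absolute upper density of $A$ is $\overline{P}(A)=\sup\{\overline{\rho}(\pi(A)):\pi \text{ a computable permutation of }\omega\}$ and the absolute lower density is $\underline{P}(A)=\inf\{\underline{\rho}(\pi(A)):\pi\text{ a computable permutation of }\omega\}$; if these agree, the common value is the intrinsic density $P(A)$. A set is intrinsically small if it has intrinsic density $0$ (equivalently $\overline{\rho}(\pi(A))=0$ for every computable permutation $\pi$); the paper uses this term for infinite sets. -}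

module Defs where

open import Data.Nat using (ℕ; zero; suc; _+_; _*_; _^_; _≤_; _<_)
open import Data.List using (List; []; _∷_; [_])
open import Data.Maybe using (Maybe; just; nothing)
open import Data.Product using (Σ; ∃; _×_; _,_)
open import Data.Empty using (⊥)
open import Relation.Nullary using (¬_)
open import Relation.Binary.PropositionalEquality using (_≡_)

Pred : Set₁
Pred = ℕ → Set

-- Oracle partial recursive functions (Kleene's μ-recursive functions
-- relative to an oracle), with a relational big-step semantics.
-- A code is applied to a list of natural-number arguments.

data Code : Set where
  zer  : Code
  succ : Code
  proj : ℕ → Code
  comp : Code → List Code → Code
  prec : Code → Code → Code
  mu   : Code → Code
  orac : Code

nth : List ℕ → ℕ → Maybe ℕ
nth []       _       = nothing
nth (x ∷ xs) zero    = just x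
nth (x ∷ xs) (suc i) = nth xs i

data _⊢_∙_⇓_ (O : Pred) : Code → List ℕ → ℕ → Set
data _⊢_∙∙_⇓⇓_ (O : Pred) : List Code → List ℕ → List ℕ → Set

data _⊢_∙_⇓_ O where
  ev-zer  : ∀ {xs} → O ⊢ zer ∙ xs ⇓ 0
  ev-succ : ∀ {x xs} → O ⊢ succ ∙ (x ∷ xs) ⇓ suc x
  ev-proj : ∀ {i xs y} → nth xs i ≡ just y → O ⊢ proj i ∙ xs ⇓ y
  ev-comp : ∀ {f gs xs ys y} → O ⊢ gs ∙∙ xs ⇓⇓ ys → O ⊢ f ∙ ys ⇓ y → O ⊢ comp f gs ∙ xs ⇓ y
  ev-prec0 : ∀ {f g xs y} → O ⊢ f ∙ xs ⇓ y → O ⊢ prec f g ∙ (0 ∷ xs) ⇓ y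
  ev-precS : ∀ {f g n xs r y} → O ⊢ prec f g ∙ (n ∷ xs) ⇓ r →
             O ⊢ g ∙ (n ∷ r ∷ xs) ⇓ y → O ⊢ prec f g ∙ (suc n ∷ xs) ⇓ y
  ev-mu   : ∀ {f xs z} → O ⊢ f ∙ (z ∷ xs) ⇓ 0 →
            (∀ w → w < z → ∃ λ v → O ⊢ f ∙ (w ∷ xs) ⇓ suc v) →
            O ⊢ mu f ∙ xs ⇓ z
  ev-orac1 : ∀ {x xs} → O x → O ⊢ orac ∙ (x ∷ xs) ⇓ 1
  ev-orac0 : ∀ {x xs} → ¬ O x → O ⊢ orac ∙ (x ∷ xs) ⇓ 0

data _⊢_∙∙_⇓⇓_ O where
  evs-[] : ∀ {xs} → O ⊢ [] ∙∙ xs ⇓⇓ []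
  evs-∷  : ∀ {g gs xs y ys} → O ⊢ g ∙ xs ⇓ y → O ⊢ gs ∙∙ xs ⇓⇓ ys →
           O ⊢ (g ∷ gs) ∙∙ xs ⇓⇓ (y ∷ ys)

pair : ℕ → ℕ → ℕ
pair a b = 2 ^ a * suc (2 * b)

encode     : Code → ℕ
encodeList : List Code → ℕ
encode zer        = pair 0 0
encode succ       = pair 1 0
encode (proj i)   = pair 2 i
encode (comp f gs) = pair 3 (pair (encode f) (encodeList gs))
encode (prec f g) = pair 4 (pair (encode f) (encode g))
encode (mu f)     = pair 5 (encode f)
encode orac       = pair 6 0
encodeList []       = 0
encodeList (c ∷ cs) = suc (pair (encode c) (encodeList cs))

∅ : Pred
∅ _ = ⊥

∅′ : Pred
∅′ n = Σ Code λ c → encode c ≡ n × ∃ λ y → ∅ ⊢ c ∙ [ n ] ⇓ y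

-- Effective join B ⊕ C = {2n : n ∈ B} ∪ {2n+1 : n ∈ C}.
_⊕_ : Pred → Pred → Pred
(B ⊕ C) zero          = B 0
(B ⊕ C) (suc zero)    = C 0
(B ⊕ C) (suc (suc m)) = ((λ n → B (suc n)) ⊕ (λ n → C (suc n))) m

_≤T_ : Pred → Pred → Set
A ≤T B = Σ Code λ c → ∀ n →
  (A n → B ⊢ c ∙ [ n ] ⇓ 1) × (¬ A n → B ⊢ c ∙ [ n ] ⇓ 0)

UniformlyComputableIn : Pred → (ℕ → Pred) → Set
UniformlyComputableIn X R = Σ Code λ c → ∀ e n →
  (R e n → X ⊢ c ∙ (e ∷ n ∷ []) ⇓ 1) × (¬ R e n → X ⊢ c ∙ (e ∷ n ∷ []) ⇓ 0)

Infinite : Pred → Set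
Infinite A = ∀ n → ∃ λ m → n ≤ m × A m

IsPermutation : (ℕ → ℕ) → Set
IsPermutation π = (∀ a b → π a ≡ π b → a ≡ b) × (∀ m → ∃ λ n → π n ≡ m)

Computable : (ℕ → ℕ) → Set
Computable π = Σ Code λ c → ∀ n → ∅ ⊢ c ∙ [ n ] ⇓ π n

Img : (ℕ → ℕ) → Pred → Pred
Img π A m = ∃ λ n → A n × π n ≡ m

data Count (A : Pred) : ℕ → ℕ → Set where
  cnt-0   : Count A 0 0
  cnt-in  : ∀ {n c} → A n → Count A n c → Count A (suc n) (suc c)
  cnt-out : ∀ {n c} → ¬ A n → Count A n c → Count A (suc n) c

-- upper density is 0:  ∀ k, eventually ρ_n(A) ≤ 1/(k+1)
UpperDensityZero : Pred → Set
UpperDensityZero A = ∀ k → ∃ λ N → ∀ n → N ≤ n → ∀ c → Count A n c → c * suc k ≤ n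

IntrinsicallySmall : Pred → Set
IntrinsicallySmall A = Infinite A ×
  (∀ π → IsPermutation π → Computable π → UpperDensityZero (Img π A))

module Submission where

-- Relative to ∅′ one can invert every computable permutation uniformly: there is a total
-- ∅′-computable β with β(y, i) = π⁻¹(y) whenever the i-th program computes a permutation π.
-- Let a_e be the least element of R_e above e and above all β(y, i) with i ≤ e and y < e².
-- Then A = {a_e} meets every R_e, is decidable from ∅′ ⊕ X because e < a_e, and for the
-- i-th permutation π and e ≥ i we get π(a_e) ≥ e², so fewer than i + √n + 1 elements of π(A)
-- lie below n. Excluded middle only decides membership in ∅′ and in the R_e, making the
-- oracle computations total.

open import Defs
open import Level using (0ℓ)
open import Axiom.ExcludedMiddle using (ExcludedMiddle)
open import Data.Nat using (ℕ; zero; suc; _+_; _*_; _∸_; _^_; _≤_; _<_; z≤n; s≤s; pred; _<?_)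
open import Data.Nat.Properties
open import Data.Nat.DivMod using (_/_; m*n/n≡m; m/n*n≤m; /-monoˡ-≤)
open import Data.List using (List; []; _∷_; [_]; length; upTo)
open import Data.List.Properties using (length-upTo; length-removeAt′)
open import Data.List.Membership.Propositional using (_∈_)
open import Data.List.Membership.Propositional.Properties using (∈-upTo⁺)
open import Data.List.Relation.Unary.Any using (here; there; _─_; index)
open import Data.Maybe.Properties using (just-injective)
open import Data.Product using (Σ; ∃; _×_; _,_; proj₁; proj₂)
open import Data.Sum using (inj₁; inj₂)
open import Function using (id)
open import Relation.Nullary using (¬_; yes; no; contradiction)
open import Relation.Binary using (tri<; tri≈; tri>)
open import Relation.Binary.PropositionalEquality hiding ([_])

⇓-deterministic  : ∀ {O c xs y y′} → O ⊢ c ∙ xs ⇓ y → O ⊢ c ∙ xs ⇓ y′ → y ≡ y′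
⇓⇓-deterministic : ∀ {O cs xs ys ys′} → O ⊢ cs ∙∙ xs ⇓⇓ ys → O ⊢ cs ∙∙ xs ⇓⇓ ys′ → ys ≡ ys′
⇓-deterministic ev-zer ev-zer = refl
⇓-deterministic ev-succ ev-succ = refl
⇓-deterministic (ev-proj p) (ev-proj q) = just-injective (trans (sym p) q)
⇓-deterministic (ev-comp ds d) (ev-comp ds′ d′) with ⇓⇓-deterministic ds ds′
... | refl = ⇓-deterministic d d′
⇓-deterministic (ev-prec0 d) (ev-prec0 d′) = ⇓-deterministic d d′
⇓-deterministic (ev-precS d e) (ev-precS d′ e′) with ⇓-deterministic d d′
... | refl = ⇓-deterministic e e′
⇓-deterministic (ev-mu {z = z} d h) (ev-mu {z = z′} d′ h′) with <-cmp z z′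
... | tri≈ _ z≡z′ _ = z≡z′
... | tri< z<z′ _ _ with h′ z z<z′
...   | _ , d″ = contradiction (⇓-deterministic d d″) 0≢1+n
⇓-deterministic (ev-mu {z = z} d h) (ev-mu {z = z′} d′ h′) | tri> _ _ z′<z with h z′ z′<z
...   | _ , d″ = contradiction (⇓-deterministic d′ d″) 0≢1+n
⇓-deterministic (ev-orac1 _) (ev-orac1 _) = refl
⇓-deterministic (ev-orac1 p) (ev-orac0 ¬p) = contradiction p ¬p
⇓-deterministic (ev-orac0 ¬p) (ev-orac1 p) = contradiction p ¬p
⇓-deterministic (ev-orac0 _) (ev-orac0 _) = refl
⇓⇓-deterministic evs-[] evs-[] = refl
⇓⇓-deterministic (evs-∷ d ds) (evs-∷ d′ ds′) = cong₂ _∷_ (⇓-deterministic d d′) (⇓⇓-deterministic ds ds′)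

comp₁ : Code → Code → Code
comp₁ f a = comp f (a ∷ [])

comp₂ : Code → Code → Code → Code
comp₂ f a b = comp f (a ∷ b ∷ [])

constC : ℕ → Code
constC zero    = zer
constC (suc n) = comp₁ succ (constC n)

double : ℕ → ℕ
double zero    = zero
double (suc n) = suc (suc (double n))

addC mulC predC monusFlipC monusC pow2C pairC doubleC : Code
addC       = prec (proj 0) (comp₁ succ (proj 1))
mulC       = prec zer (comp₂ addC (proj 2) (proj 1))
predC      = prec zer (proj 0)
monusFlipC = prec (proj 0) (comp₁ predC (proj 1))
monusC     = comp₂ monusFlipC (proj 1) (proj 0)
pow2C      = prec (constC 1) (comp₂ mulC (constC 2) (proj 1))
pairC      = comp₂ mulC (comp₁ pow2C (proj 0)) (comp₁ succ (comp₂ mulC (constC 2) (proj 1)))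
doubleC    = prec zer (comp₁ succ (comp₁ succ (proj 1)))

⟪_,_⟫ : Code → Code → Code
⟪ a , b ⟫ = comp₂ pairC a b

module _ {O : Pred} where

  comp₁⇓ : ∀ {f a xs u w} → O ⊢ a ∙ xs ⇓ u → O ⊢ f ∙ [ u ] ⇓ w → O ⊢ comp₁ f a ∙ xs ⇓ w
  comp₁⇓ a⇓ f⇓ = ev-comp (evs-∷ a⇓ evs-[]) f⇓

  comp₂⇓ : ∀ {f a b xs u v w} → O ⊢ a ∙ xs ⇓ u → O ⊢ b ∙ xs ⇓ v → O ⊢ f ∙ (u ∷ v ∷ []) ⇓ w →
           O ⊢ comp₂ f a b ∙ xs ⇓ w
  comp₂⇓ a⇓ b⇓ f⇓ = ev-comp (evs-∷ a⇓ (evs-∷ b⇓ evs-[])) f⇓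

  proj₀⇓ : ∀ {x xs} → O ⊢ proj 0 ∙ (x ∷ xs) ⇓ x
  proj₀⇓ = ev-proj refl

  constC⇓ : ∀ n {xs} → O ⊢ constC n ∙ xs ⇓ n
  constC⇓ zero    = ev-zer
  constC⇓ (suc n) = comp₁⇓ (constC⇓ n) ev-succ

  addC⇓ : ∀ n {m xs} → O ⊢ addC ∙ (n ∷ m ∷ xs) ⇓ (n + m)
  addC⇓ zero    = ev-prec0 proj₀⇓
  addC⇓ (suc n) = ev-precS (addC⇓ n) (comp₁⇓ (ev-proj refl) ev-succ)

  mulC⇓ : ∀ n {m xs} → O ⊢ mulC ∙ (n ∷ m ∷ xs) ⇓ (n * m)
  mulC⇓ zero        = ev-prec0 ev-zer
  mulC⇓ (suc n) {m} = ev-precS (mulC⇓ n) (comp₂⇓ (ev-proj refl) (ev-proj refl) (addC⇓ m))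

  predC⇓ : ∀ n {xs} → O ⊢ predC ∙ (n ∷ xs) ⇓ (pred n)
  predC⇓ zero    = ev-prec0 ev-zer
  predC⇓ (suc n) = ev-precS (predC⇓ n) proj₀⇓

  monusFlipC⇓ : ∀ b {a xs} → O ⊢ monusFlipC ∙ (b ∷ a ∷ xs) ⇓ (a ∸ b)
  monusFlipC⇓ zero            = ev-prec0 proj₀⇓
  monusFlipC⇓ (suc b) {a} {xs} = subst (λ r → O ⊢ monusFlipC ∙ (suc b ∷ a ∷ xs) ⇓ r) (pred[m∸n]≡m∸[1+n] a b)
    (ev-precS (monusFlipC⇓ b) (comp₁⇓ (ev-proj refl) (predC⇓ (a ∸ b))))

  monusC⇓ : ∀ a b {xs} → O ⊢ monusC ∙ (a ∷ b ∷ xs) ⇓ (a ∸ b)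
  monusC⇓ a b = comp₂⇓ (ev-proj refl) proj₀⇓ (monusFlipC⇓ b)

  pow2C⇓ : ∀ n {xs} → O ⊢ pow2C ∙ (n ∷ xs) ⇓ (2 ^ n)
  pow2C⇓ zero    = ev-prec0 (constC⇓ 1)
  pow2C⇓ (suc n) = ev-precS (pow2C⇓ n) (comp₂⇓ (constC⇓ 2) (ev-proj refl) (mulC⇓ 2))

  pairC⇓ : ∀ a b {xs} → O ⊢ pairC ∙ (a ∷ b ∷ xs) ⇓ (pair a b)
  pairC⇓ a b = comp₂⇓ (comp₁⇓ proj₀⇓ (pow2C⇓ a))
                      (comp₁⇓ (comp₂⇓ (constC⇓ 2) (ev-proj refl) (mulC⇓ 2)) ev-succ)
                      (mulC⇓ (2 ^ a))

  ⟪,⟫⇓ : ∀ {a b xs u v} → O ⊢ a ∙ xs ⇓ u → O ⊢ b ∙ xs ⇓ v → O ⊢ ⟪ a , b ⟫ ∙ xs ⇓ (pair u v)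
  ⟪,⟫⇓ {u = u} {v} a⇓ b⇓ = comp₂⇓ a⇓ b⇓ (pairC⇓ u v)

  doubleC⇓ : ∀ n {xs} → O ⊢ doubleC ∙ (n ∷ xs) ⇓ (double n)
  doubleC⇓ zero    = ev-prec0 ev-zer
  doubleC⇓ (suc n) = ev-precS (doubleC⇓ n) (comp₁⇓ (comp₁⇓ (ev-proj refl) ev-succ) ev-succ)

module _ {O : Pred} {f : Code} {xs : List ℕ} (f-total : ∀ w → ∃ λ v → O ⊢ f ∙ (w ∷ xs) ⇓ v) where

  mu-halts : ∀ {z} → O ⊢ f ∙ (z ∷ xs) ⇓ 0 → ∃ λ z′ → O ⊢ mu f ∙ xs ⇓ z′ × O ⊢ f ∙ (z′ ∷ xs) ⇓ 0
  mu-halts {z} fz⇓ = search 0 z fz⇓ (λ _ ())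
    where
      search : ∀ k d → O ⊢ f ∙ (k + d ∷ xs) ⇓ 0 → (∀ w → w < k → ∃ λ v → O ⊢ f ∙ (w ∷ xs) ⇓ suc v) →
               ∃ λ z′ → O ⊢ mu f ∙ xs ⇓ z′ × O ⊢ f ∙ (z′ ∷ xs) ⇓ 0
      search k d fz⇓ below with f-total k
      ... | zero , fk⇓ = k , ev-mu fk⇓ below , fk⇓
      search k zero fz⇓ below | suc v , fk⇓ =
        contradiction (⇓-deterministic (subst (λ t → O ⊢ f ∙ (t ∷ xs) ⇓ 0) (+-identityʳ k) fz⇓) fk⇓) 0≢1+n
      search k (suc d) fz⇓ below | suc v , fk⇓ =
        search (suc k) d (subst (λ t → O ⊢ f ∙ (t ∷ xs) ⇓ 0) (+-suc k d) fz⇓) below′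
        where
          below′ : ∀ w → w < suc k → ∃ λ v → O ⊢ f ∙ (w ∷ xs) ⇓ suc v
          below′ w w<1+k with m<1+n⇒m<n∨m≡n w<1+k
          ... | inj₁ w<k  = below w w<k
          ... | inj₂ refl = v , fk⇓

sumC : Code → Code
sumC f = prec zer (comp₂ addC (comp₂ f (proj 0) (proj 2)) (proj 1))

record BoundedSum (O : Pred) (f : Code) (n x : ℕ) : Set where
  field
    value         : ℕ
    sumC⇓         : O ⊢ sumC f ∙ (n ∷ x ∷ []) ⇓ value
    summand≤      : ∀ {j v} → j < n → O ⊢ f ∙ (j ∷ x ∷ []) ⇓ v → v ≤ value
    zero-summands : (∀ {j v} → j < n → O ⊢ f ∙ (j ∷ x ∷ []) ⇓ v → v ≡ 0) → value ≡ 0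

boundedSum : ∀ {O f x} n → (∀ j → j < n → ∃ λ v → O ⊢ f ∙ (j ∷ x ∷ []) ⇓ v) → BoundedSum O f n x
boundedSum zero _ = record
  { value = 0 ; sumC⇓ = ev-prec0 ev-zer ; summand≤ = λ () ; zero-summands = λ _ → refl }
boundedSum {O} {f} {x} (suc n) f-total = record
  { value         = v + value
  ; sumC⇓         = ev-precS sumC⇓ (comp₂⇓ (comp₂⇓ (ev-proj refl) (ev-proj refl) fn⇓) (ev-proj refl) (addC⇓ v))
  ; summand≤      = summand≤′
  ; zero-summands = λ h → cong₂ _+_ (h ≤-refl fn⇓) (zero-summands (λ j<n → h (m<n⇒m<1+n j<n)))
  }
  where
    open BoundedSum (boundedSum n (λ j j<n → f-total j (m<n⇒m<1+n j<n)))
    v : ℕ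
    v = proj₁ (f-total n ≤-refl)
    fn⇓ : O ⊢ f ∙ (n ∷ x ∷ []) ⇓ v
    fn⇓ = proj₂ (f-total n ≤-refl)
    summand≤′ : ∀ {j w} → j < suc n → O ⊢ f ∙ (j ∷ x ∷ []) ⇓ w → w ≤ v + value
    summand≤′ j<1+n fj⇓ with m<1+n⇒m<n∨m≡n j<1+n
    ... | inj₁ j<n  = ≤-trans (summand≤ j<n fj⇓) (m≤n+m value v)
    ... | inj₂ refl = ≤-trans (≤-reflexive (⇓-deterministic fj⇓ fn⇓)) (m≤m+n v value)

⊕-double : ∀ B C n → (B ⊕ C) (double n) ≡ B n
⊕-double B C zero    = refl
⊕-double B C (suc n) = ⊕-double (λ m → B (suc m)) (λ m → C (suc m)) n

⊕-suc-double : ∀ B C n → (B ⊕ C) (suc (double n)) ≡ C n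
⊕-suc-double B C zero    = refl
⊕-suc-double B C (suc n) = ⊕-suc-double (λ m → B (suc m)) (λ m → C (suc m)) n

askˡ askʳ : Code → Code
askˡ a = comp₁ orac (comp₁ doubleC a)
askʳ a = comp₁ orac (comp₁ succ (comp₁ doubleC a))

module _ {B C : Pred} {a : Code} {xs : List ℕ} {n : ℕ} (a⇓ : (B ⊕ C) ⊢ a ∙ xs ⇓ n) where

  askˡ-yes : B n → (B ⊕ C) ⊢ askˡ a ∙ xs ⇓ 1
  askˡ-yes b = comp₁⇓ (comp₁⇓ a⇓ (doubleC⇓ n)) (ev-orac1 (subst id (sym (⊕-double B C n)) b))

  askˡ-no : ¬ B n → (B ⊕ C) ⊢ askˡ a ∙ xs ⇓ 0
  askˡ-no ¬b = comp₁⇓ (comp₁⇓ a⇓ (doubleC⇓ n)) (ev-orac0 (λ b → ¬b (subst id (⊕-double B C n) b)))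

  askʳ-yes : C n → (B ⊕ C) ⊢ askʳ a ∙ xs ⇓ 1
  askʳ-yes c = comp₁⇓ (comp₁⇓ (comp₁⇓ a⇓ (doubleC⇓ n)) ev-succ)
                      (ev-orac1 (subst id (sym (⊕-suc-double B C n)) c))

  askʳ-no : ¬ C n → (B ⊕ C) ⊢ askʳ a ∙ xs ⇓ 0
  askʳ-no ¬c = comp₁⇓ (comp₁⇓ (comp₁⇓ a⇓ (doubleC⇓ n)) ev-succ)
                      (ev-orac0 (λ c → ¬c (subst id (⊕-suc-double B C n) c)))

relativize  : Code → Code
relativizeL : List Code → List Code
relativize zer         = zer
relativize succ        = succ
relativize (proj i)    = proj i
relativize (comp f gs) = comp (relativize f) (relativizeL gs)
relativize (prec f g)  = prec (relativize f) (relativize g)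
relativize (mu f)      = mu (relativize f)
relativize orac        = askʳ (proj 0)
relativizeL []       = []
relativizeL (c ∷ cs) = relativize c ∷ relativizeL cs

module _ {Z X : Pred} where

  relativize⇓  : ∀ {c xs y} → X ⊢ c ∙ xs ⇓ y → (Z ⊕ X) ⊢ relativize c ∙ xs ⇓ y
  relativizeL⇓ : ∀ {cs xs ys} → X ⊢ cs ∙∙ xs ⇓⇓ ys → (Z ⊕ X) ⊢ relativizeL cs ∙∙ xs ⇓⇓ ys
  relativize⇓ ev-zer          = ev-zer
  relativize⇓ ev-succ         = ev-succ
  relativize⇓ (ev-proj p)     = ev-proj p
  relativize⇓ (ev-comp ds d)  = ev-comp (relativizeL⇓ ds) (relativize⇓ d)
  relativize⇓ (ev-prec0 d)    = ev-prec0 (relativize⇓ d)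
  relativize⇓ (ev-precS d e)  = ev-precS (relativize⇓ d) (relativize⇓ e)
  relativize⇓ (ev-mu d below) =
    ev-mu (relativize⇓ d) (λ w w<z → let v , d′ = below w w<z in v , relativize⇓ d′)
  relativize⇓ (ev-orac1 x∈X)  = askʳ-yes proj₀⇓ x∈X
  relativize⇓ (ev-orac0 x∉X)  = askʳ-no proj₀⇓ x∉X
  relativizeL⇓ evs-[]       = evs-[]
  relativizeL⇓ (evs-∷ d ds) = evs-∷ (relativize⇓ d) (relativizeL⇓ ds)

pair-zero : ∀ b → pair 0 b ≡ suc (2 * b)
pair-zero b = +-identityʳ (suc (2 * b))

pair-suc : ∀ a b → pair (suc a) b ≡ 2 * pair a b
pair-suc a b = *-assoc 2 (2 ^ a) (suc (2 * b))

pair-injective : ∀ {a b a′ b′} → pair a b ≡ pair a′ b′ → a ≡ a′ × b ≡ b′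
pair-injective {zero} {b} {zero} {b′} p =
  refl , *-cancelˡ-≡ b b′ 2 (suc-injective (trans (sym (pair-zero b)) (trans p (pair-zero b′))))
pair-injective {zero} {b} {suc a′} {b′} p =
  contradiction (trans (sym (pair-suc a′ b′)) (trans (sym p) (pair-zero b))) (even≢odd (pair a′ b′) b)
pair-injective {suc a} {b} {zero} {b′} p =
  contradiction (trans (sym (pair-suc a b)) (trans p (pair-zero b′))) (even≢odd (pair a b) b′)
pair-injective {suc a} {b} {suc a′} {b′} p
  with pair-injective {a} {b} {a′} {b′}
         (*-cancelˡ-≡ _ _ 2 (trans (sym (pair-suc a b)) (trans p (pair-suc a′ b′))))
... | refl , b≡b′ = refl , b≡b′

tag : Code → ℕ
tag zer        = 0
tag succ       = 1
tag (proj _)   = 2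
tag (comp _ _) = 3
tag (prec _ _) = 4
tag (mu _)     = 5
tag orac       = 6

arguments : Code → ℕ
arguments zer         = 0
arguments succ        = 0
arguments (proj i)    = i
arguments (comp f gs) = pair (encode f) (encodeList gs)
arguments (prec f g)  = pair (encode f) (encode g)
arguments (mu f)      = encode f
arguments orac        = 0

encode≡pair : ∀ c → encode c ≡ pair (tag c) (arguments c)
encode≡pair zer        = refl
encode≡pair succ       = refl
encode≡pair (proj _)   = refl
encode≡pair (comp _ _) = refl
encode≡pair (prec _ _) = refl
encode≡pair (mu _)     = refl
encode≡pair orac       = refl

encode-injective     : ∀ c d → encode c ≡ encode d → c ≡ d
encodeList-injective : ∀ cs ds → encodeList cs ≡ encodeList ds → cs ≡ ds
tag-arguments-injective : ∀ c d → tag c ≡ tag d → arguments c ≡ arguments d → c ≡ d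

encode-injective c d p =
  let tag≡ , arguments≡ = pair-injective (trans (sym (encode≡pair c)) (trans p (encode≡pair d)))
  in tag-arguments-injective c d tag≡ arguments≡

-- The omitted clauses, for distinct constructors, are absurd: their tags differ.
tag-arguments-injective zer      zer      refl _ = refl
tag-arguments-injective succ     succ     refl _ = refl
tag-arguments-injective (proj _) (proj _) refl p = cong proj p
tag-arguments-injective (comp f gs) (comp f′ gs′) refl p =
  let f≡ , gs≡ = pair-injective p in cong₂ comp (encode-injective f f′ f≡) (encodeList-injective gs gs′ gs≡)
tag-arguments-injective (prec f g) (prec f′ g′) refl p =
  let f≡ , g≡ = pair-injective p in cong₂ prec (encode-injective f f′ f≡) (encode-injective g g′ g≡)
tag-arguments-injective (mu f) (mu f′) refl p = cong mu (encode-injective f f′ p)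
tag-arguments-injective orac orac refl _ = refl

encodeList-injective []       []       _ = refl
encodeList-injective (c ∷ cs) (d ∷ ds) p =
  let c≡ , cs≡ = pair-injective (suc-injective p) in cong₂ _∷_ (encode-injective c d c≡) (encodeList-injective cs ds cs≡)

quoteC  : Code → Code
quoteLC : List Code → Code
quoteC zer         = ⟪ constC 0 , constC 0 ⟫
quoteC succ        = ⟪ constC 1 , constC 0 ⟫
quoteC (proj i)    = ⟪ constC 2 , constC i ⟫
quoteC (comp f gs) = ⟪ constC 3 , ⟪ quoteC f , quoteLC gs ⟫ ⟫
quoteC (prec f g)  = ⟪ constC 4 , ⟪ quoteC f , quoteC g ⟫ ⟫
quoteC (mu f)      = ⟪ constC 5 , quoteC f ⟫
quoteC orac        = ⟪ constC 6 , constC 0 ⟫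
quoteLC []       = constC 0
quoteLC (c ∷ cs) = comp₁ succ ⟪ quoteC c , quoteLC cs ⟫

encodeConstC : Code
encodeConstC = prec (quoteC zer) ⟪ constC 3 , ⟪ quoteC succ , comp₁ succ ⟪ proj 1 , constC 0 ⟫ ⟫ ⟫

module _ {O : Pred} where

  quoteC⇓  : ∀ c {xs} → O ⊢ quoteC c ∙ xs ⇓ encode c
  quoteLC⇓ : ∀ cs {xs} → O ⊢ quoteLC cs ∙ xs ⇓ encodeList cs
  quoteC⇓ zer         = ⟪,⟫⇓ (constC⇓ 0) (constC⇓ 0)
  quoteC⇓ succ        = ⟪,⟫⇓ (constC⇓ 1) (constC⇓ 0)
  quoteC⇓ (proj i)    = ⟪,⟫⇓ (constC⇓ 2) (constC⇓ i)
  quoteC⇓ (comp f gs) = ⟪,⟫⇓ (constC⇓ 3) (⟪,⟫⇓ (quoteC⇓ f) (quoteLC⇓ gs))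
  quoteC⇓ (prec f g)  = ⟪,⟫⇓ (constC⇓ 4) (⟪,⟫⇓ (quoteC⇓ f) (quoteC⇓ g))
  quoteC⇓ (mu f)      = ⟪,⟫⇓ (constC⇓ 5) (quoteC⇓ f)
  quoteC⇓ orac        = ⟪,⟫⇓ (constC⇓ 6) (constC⇓ 0)
  quoteLC⇓ []       = constC⇓ 0
  quoteLC⇓ (c ∷ cs) = comp₁⇓ (⟪,⟫⇓ (quoteC⇓ c) (quoteLC⇓ cs)) ev-succ

  encodeConstC⇓ : ∀ n {xs} → O ⊢ encodeConstC ∙ (n ∷ xs) ⇓ encode (constC n)
  encodeConstC⇓ zero    = ev-prec0 (quoteC⇓ zer)
  encodeConstC⇓ (suc n) = ev-precS (encodeConstC⇓ n)
    (⟪,⟫⇓ (constC⇓ 3) (⟪,⟫⇓ (quoteC⇓ succ) (comp₁⇓ (⟪,⟫⇓ (ev-proj refl) (constC⇓ 0)) ev-succ)))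

dist : ℕ → ℕ → ℕ
dist a b = (a ∸ b) + (b ∸ a)

dist-self : ∀ a → dist a a ≡ 0
dist-self a = cong₂ _+_ (n∸n≡0 a) (n∸n≡0 a)

dist≡0⇒≡ : ∀ a b → dist a b ≡ 0 → a ≡ b
dist≡0⇒≡ a b p = ≤-antisym (m∸n≡0⇒m≤n (m+n≡0⇒m≡0 (a ∸ b) p)) (m∸n≡0⇒m≤n (m+n≡0⇒n≡0 (a ∸ b) p))

1∸dist≡0 : ∀ {a b} → a ≢ b → 1 ∸ dist a b ≡ 0
1∸dist≡0 {a} {b} a≢b = m≤n⇒m∸n≡0 (n≢0⇒n>0 (λ d≡0 → a≢b (dist≡0⇒≡ a b d≡0)))

1∸[1∸n]≡1 : ∀ {n} → 1 ≤ n → 1 ∸ (1 ∸ n) ≡ 1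
1∸[1∸n]≡1 {suc n} _ = cong (1 ∸_) (0∸n≡0 n)

-- Opaque, so that the Gödel numbers mentioning distC below are not unfolded during type checking.
opaque
  distC : Code
  distC = comp₂ addC monusC (comp₂ monusC (proj 1) (proj 0))

  distC⇓ : ∀ {O} a b {xs} → O ⊢ distC ∙ (a ∷ b ∷ xs) ⇓ dist a b
  distC⇓ a b = comp₂⇓ (monusC⇓ a b) (comp₂⇓ (ev-proj refl) proj₀⇓ (monusC⇓ b a)) (addC⇓ (a ∸ b))

module _ {O : Pred} where

  distC-zero : ∀ {a b xs u} → O ⊢ a ∙ xs ⇓ u → O ⊢ b ∙ xs ⇓ u → O ⊢ comp₂ distC a b ∙ xs ⇓ 0
  distC-zero {u = u} a⇓ b⇓ = comp₂⇓ a⇓ b⇓ (subst (λ r → O ⊢ distC ∙ (u ∷ u ∷ []) ⇓ r) (dist-self u) (distC⇓ u u))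

  distC-zero⁻¹ : ∀ {a b xs} → O ⊢ comp₂ distC a b ∙ xs ⇓ 0 → ∃ λ u → O ⊢ a ∙ xs ⇓ u × O ⊢ b ∙ xs ⇓ u
  distC-zero⁻¹ (ev-comp (evs-∷ {y = u} a⇓ (evs-∷ {y = v} b⇓ evs-[])) d⇓)
    with dist≡0⇒≡ u v (⇓-deterministic (distC⇓ u v) d⇓)
  ... | refl = u , a⇓ , b⇓

findC : Code → ℕ → Code
findC c y = mu (comp₂ distC (comp₁ c (proj 0)) (constC y))

checkC : Code → ℕ → ℕ → Code
checkC c x y = mu (comp₂ distC (comp₁ c (constC x)) (constC y))

module _ {O : Pred} where

  checkC-halts : ∀ {c x y xs} → O ⊢ c ∙ [ x ] ⇓ y → O ⊢ checkC c x y ∙ xs ⇓ 0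
  checkC-halts {x = x} {y} c⇓ = ev-mu (distC-zero (comp₁⇓ (constC⇓ x) c⇓) (constC⇓ y)) (λ _ ())

  checkC-sound : ∀ {c x y xs z} → O ⊢ checkC c x y ∙ xs ⇓ z → O ⊢ c ∙ [ x ] ⇓ y
  checkC-sound {x = x} {y} (ev-mu root⇓ _) with distC-zero⁻¹ root⇓
  ... | _ , ev-comp (evs-∷ x⇓ evs-[]) c⇓ , y⇓
    rewrite ⇓-deterministic x⇓ (constC⇓ x) | ⇓-deterministic y⇓ (constC⇓ y) = c⇓

  findC-halts : ∀ {c y z xs} → (∀ w → ∃ λ v → O ⊢ c ∙ [ w ] ⇓ v) → O ⊢ c ∙ [ z ] ⇓ y →
                ∃ λ z′ → O ⊢ findC c y ∙ xs ⇓ z′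
  findC-halts {c} {y} {xs = xs} c-total c⇓ =
    let z′ , findC⇓ , _ = mu-halts root-total (distC-zero (comp₁⇓ proj₀⇓ c⇓) (constC⇓ y)) in z′ , findC⇓
    where
      root-total : ∀ w → ∃ λ v → O ⊢ comp₂ distC (comp₁ c (proj 0)) (constC y) ∙ (w ∷ xs) ⇓ v
      root-total w = let v , c⇓ = c-total w in dist v y , comp₂⇓ (comp₁⇓ proj₀⇓ c⇓) (constC⇓ y) (distC⇓ v y)

  findC-sound : ∀ {c y xs z} → O ⊢ findC c y ∙ xs ⇓ z → O ⊢ c ∙ [ z ] ⇓ y
  findC-sound {y = y} (ev-mu root⇓ _) with distC-zero⁻¹ root⇓
  ... | _ , ev-comp (evs-∷ (ev-proj refl) evs-[]) c⇓ , y⇓ rewrite ⇓-deterministic y⇓ (constC⇓ y) = c⇓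

-- Defined for all numbers, not only codes, so that a computation can query ∅′ about them.
opaque
  findNum : ℕ → ℕ → ℕ
  findNum y i = pair 5 (pair 3 (pair (encode distC)
    (suc (pair (pair 3 (pair i (encodeList [ proj 0 ]))) (suc (pair (encode (constC y)) 0))))))

  checkNum : ℕ → ℕ → ℕ
  checkNum n x = pair 5 (pair 3 (pair (encode distC)
    (suc (pair (pair 3 (pair n (suc (pair (encode (constC n)) 0)))) (suc (pair (encode (constC x)) 0))))))

  findNum-encode : ∀ c y → findNum y (encode c) ≡ encode (findC c y)
  findNum-encode c y = refl

  checkNum-encode : ∀ c x → checkNum (encode c) x ≡ encode (checkC c (encode c) x)
  checkNum-encode c x = refl

  findNumC checkNumC : Code
  findNumC = ⟪ constC 5 , ⟪ constC 3 , ⟪ quoteC distC , comp₁ succ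
    ⟪ ⟪ constC 3 , ⟪ proj 1 , quoteLC [ proj 0 ] ⟫ ⟫ , comp₁ succ ⟪ comp₁ encodeConstC (proj 0) , constC 0 ⟫ ⟫ ⟫ ⟫ ⟫
  checkNumC = ⟪ constC 5 , ⟪ constC 3 , ⟪ quoteC distC , comp₁ succ
    ⟪ ⟪ constC 3 , ⟪ proj 0 , comp₁ succ ⟪ comp₁ encodeConstC (proj 0) , constC 0 ⟫ ⟫ ⟫ ,
      comp₁ succ ⟪ comp₁ encodeConstC (proj 1) , constC 0 ⟫ ⟫ ⟫ ⟫ ⟫

  findNumC⇓ : ∀ {O} y i {xs} → O ⊢ findNumC ∙ (y ∷ i ∷ xs) ⇓ findNum y i
  findNumC⇓ y i = ⟪,⟫⇓ (constC⇓ 5) (⟪,⟫⇓ (constC⇓ 3) (⟪,⟫⇓ (quoteC⇓ distC) (comp₁⇓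
    (⟪,⟫⇓ (⟪,⟫⇓ (constC⇓ 3) (⟪,⟫⇓ (ev-proj refl) (quoteLC⇓ [ proj 0 ])))
          (comp₁⇓ (⟪,⟫⇓ (comp₁⇓ proj₀⇓ (encodeConstC⇓ y)) (constC⇓ 0)) ev-succ)) ev-succ)))

  checkNumC⇓ : ∀ {O} n x {xs} → O ⊢ checkNumC ∙ (n ∷ x ∷ xs) ⇓ checkNum n x
  checkNumC⇓ n x = ⟪,⟫⇓ (constC⇓ 5) (⟪,⟫⇓ (constC⇓ 3) (⟪,⟫⇓ (quoteC⇓ distC) (comp₁⇓
    (⟪,⟫⇓ (⟪,⟫⇓ (constC⇓ 3) (⟪,⟫⇓ proj₀⇓ (comp₁⇓ (⟪,⟫⇓ (comp₁⇓ proj₀⇓ (encodeConstC⇓ n)) (constC⇓ 0)) ev-succ)))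
          (comp₁⇓ (⟪,⟫⇓ (comp₁⇓ (ev-proj refl) (encodeConstC⇓ x)) (constC⇓ 0)) ev-succ)) ev-succ)))

∅′-intro : ∀ {c y} → ∅ ⊢ c ∙ [ encode c ] ⇓ y → ∅′ (encode c)
∅′-intro c⇓ = _ , refl , _ , c⇓

∅′-elim : ∀ c → ∅′ (encode c) → ∃ λ y → ∅ ⊢ c ∙ [ encode c ] ⇓ y
∅′-elim c (d , d≡c , y , d⇓) with encode-injective d c d≡c
... | refl = y , d⇓

found-intro : ∀ {c y z} → (∀ w → ∃ λ v → ∅ ⊢ c ∙ [ w ] ⇓ v) → ∅ ⊢ c ∙ [ z ] ⇓ y → ∅′ (findNum y (encode c))
found-intro {c} {y} c-total c⇓ =
  subst ∅′ (sym (findNum-encode c y)) (∅′-intro (proj₂ (findC-halts c-total c⇓)))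

hit-intro : ∀ {c x} → ∅ ⊢ c ∙ [ encode c ] ⇓ x → ∅′ (checkNum (encode c) x)
hit-intro {c} {x} c⇓ = subst ∅′ (sym (checkNum-encode c x)) (∅′-intro (checkC-halts c⇓))

hit-elim : ∀ c {x} → ∅′ (checkNum (encode c) x) → ∅ ⊢ c ∙ [ encode c ] ⇓ x
hit-elim c {x} hit =
  checkC-sound (proj₂ (∅′-elim (checkC c (encode c) x) (subst ∅′ (checkNum-encode c x) hit)))

-- Relative to ∅′, β(y, i) = μx. [findNum y i ∉ ∅′, or program findNum y i outputs x on its own number].
-- If i = encode c and c computes a permutation π, that program is findC c y and β(y, i) = π⁻¹(y).
module PreimageSearch (em : ExcludedMiddle 0ℓ) (C : Pred) where

  O : Pred
  O = ∅′ ⊕ C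

  foundNumC hitNumC foundQ hitQ preimageTestC preimageC : Code
  foundNumC     = comp₂ findNumC (proj 1) (proj 2)
  hitNumC       = comp₂ checkNumC foundNumC (proj 0)
  foundQ        = askˡ foundNumC
  hitQ          = askˡ hitNumC
  preimageTestC = comp₂ monusC (constC 1) (comp₂ addC hitQ (comp₂ monusC (constC 1) foundQ))
  preimageC     = mu preimageTestC

  module _ {x y i : ℕ} where

    foundNumC⇓ : O ⊢ foundNumC ∙ (x ∷ y ∷ i ∷ []) ⇓ findNum y i
    foundNumC⇓ = comp₂⇓ (ev-proj refl) (ev-proj refl) (findNumC⇓ y i)

    hitNumC⇓ : O ⊢ hitNumC ∙ (x ∷ y ∷ i ∷ []) ⇓ checkNum (findNum y i) x
    hitNumC⇓ = comp₂⇓ foundNumC⇓ proj₀⇓ (checkNumC⇓ (findNum y i) x)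

    preimageTestC⇓ : ∀ {h f} → O ⊢ hitQ ∙ (x ∷ y ∷ i ∷ []) ⇓ h → O ⊢ foundQ ∙ (x ∷ y ∷ i ∷ []) ⇓ f →
                     O ⊢ preimageTestC ∙ (x ∷ y ∷ i ∷ []) ⇓ (1 ∸ (h + (1 ∸ f)))
    preimageTestC⇓ {h} {f} h⇓ f⇓ =
      comp₂⇓ (constC⇓ 1) (comp₂⇓ h⇓ (comp₂⇓ (constC⇓ 1) f⇓ (monusC⇓ 1 f)) (addC⇓ h)) (monusC⇓ 1 _)

    preimageTestC-zero : ∀ {h f} → O ⊢ hitQ ∙ (x ∷ y ∷ i ∷ []) ⇓ h → O ⊢ foundQ ∙ (x ∷ y ∷ i ∷ []) ⇓ f →
                         1 ≤ h + (1 ∸ f) → O ⊢ preimageTestC ∙ (x ∷ y ∷ i ∷ []) ⇓ 0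
    preimageTestC-zero h⇓ f⇓ 1≤ =
      subst (λ r → O ⊢ preimageTestC ∙ (x ∷ y ∷ i ∷ []) ⇓ r) (m≤n⇒m∸n≡0 1≤) (preimageTestC⇓ h⇓ f⇓)

  askˡ-total : ∀ {a xs n} → O ⊢ a ∙ xs ⇓ n → ∃ λ b → O ⊢ askˡ a ∙ xs ⇓ b
  askˡ-total {n = n} a⇓ with em {∅′ n}
  ... | yes n∈∅′ = 1 , askˡ-yes a⇓ n∈∅′
  ... | no  n∉∅′ = 0 , askˡ-no a⇓ n∉∅′

  preimageTestC-total : ∀ y i x → ∃ λ v → O ⊢ preimageTestC ∙ (x ∷ y ∷ i ∷ []) ⇓ v
  preimageTestC-total y i x =
    let _ , h⇓ = askˡ-total hitNumC⇓ ; _ , f⇓ = askˡ-total foundNumC⇓ in _ , preimageTestC⇓ h⇓ f⇓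

  preimageTestC-root : ∀ y i → ∃ λ x → O ⊢ preimageTestC ∙ (x ∷ y ∷ i ∷ []) ⇓ 0
  preimageTestC-root y i with em {∅′ (findNum y i)}
  ... | no not-found =
    let h , h⇓ = askˡ-total hitNumC⇓ in 0 , preimageTestC-zero h⇓ (askˡ-no foundNumC⇓ not-found) (m≤n+m 1 h)
  ... | yes (d , d≡ , v , d⇓) =
    let f , f⇓ = askˡ-total foundNumC⇓
        hit = subst (λ n → ∅′ (checkNum n v)) d≡ (hit-intro (subst (λ n → ∅ ⊢ d ∙ [ n ] ⇓ v) (sym d≡) d⇓))
    in v , preimageTestC-zero (askˡ-yes hitNumC⇓ hit) f⇓ (m≤m+n 1 (1 ∸ f))

  preimageC-total : ∀ y i → ∃ λ b → O ⊢ preimageC ∙ (y ∷ i ∷ []) ⇓ b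
  preimageC-total y i =
    let x , root⇓ = preimageTestC-root y i ; b , b⇓ , _ = mu-halts (preimageTestC-total y i) root⇓ in b , b⇓

  preimageC-inverts : ∀ {π : ℕ → ℕ} {c} → (∀ n → ∅ ⊢ c ∙ [ n ] ⇓ π n) → (∀ m → ∃ λ n → π n ≡ m) →
                      ∀ {y b} → O ⊢ preimageC ∙ (y ∷ encode c ∷ []) ⇓ b → π b ≡ y
  preimageC-inverts {π} {c} c⇓ π-onto {y} {b} (ev-mu test⇓ _) with em {∅′ (checkNum (findNum y (encode c)) b)}
  ... | no not-hit =
    contradiction (⇓-deterministic test⇓ (preimageTestC⇓ (askˡ-no hitNumC⇓ not-hit) (askˡ-yes foundNumC⇓ found)))
                  0≢1+n
    where
      found : ∅′ (findNum y (encode c))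
      found with π-onto y
      ... | z , refl = found-intro (λ w → π w , c⇓ w) (c⇓ z)
  ... | yes hit =
    let search = findC c y
        search⇓ = hit-elim search (subst (λ n → ∅′ (checkNum n b)) (findNum-encode c y) hit)
    in ⇓-deterministic (c⇓ b) (findC-sound search⇓)

  squareRowC preimageBoundC : Code
  squareRowC     = comp₂ (sumC preimageC) (comp₂ mulC (proj 1) (proj 1)) (proj 0)
  preimageBoundC = comp₂ (sumC squareRowC) (comp₁ succ (proj 0)) (proj 0)

  preimageBound : ∀ e → ∃ λ S → O ⊢ preimageBoundC ∙ [ e ] ⇓ S ×
                  (∀ {i y b} → i ≤ e → y < e * e → O ⊢ preimageC ∙ (y ∷ i ∷ []) ⇓ b → b ≤ S)
  preimageBound e =
    value , comp₂⇓ (comp₁⇓ proj₀⇓ ev-succ) proj₀⇓ sumC⇓ ,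
    λ {i} i≤e y<ee b⇓ → ≤-trans (BoundedSum.summand≤ (row i) y<ee b⇓) (summand≤ (s≤s i≤e) (squareRowC⇓ i))
    where
      row : ∀ i → BoundedSum O preimageC (e * e) i
      row i = boundedSum (e * e) (λ y _ → preimageC-total y i)
      squareRowC⇓ : ∀ i → O ⊢ squareRowC ∙ (i ∷ e ∷ []) ⇓ BoundedSum.value (row i)
      squareRowC⇓ i = comp₂⇓ (comp₂⇓ (ev-proj refl) (ev-proj refl) (mulC⇓ e)) proj₀⇓ (BoundedSum.sumC⇓ (row i))
      open BoundedSum (boundedSum (suc e) (λ i _ → _ , squareRowC⇓ i))

∈-─ : ∀ {A : Set} {x y : A} {xs} (x∈xs : x ∈ xs) → y ∈ xs → y ≢ x → y ∈ (xs ─ x∈xs)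
∈-─ (here refl)  (here refl)  y≢x = contradiction refl y≢x
∈-─ (here refl)  (there y∈xs) _   = y∈xs
∈-─ (there x∈xs) (here refl)  _   = here refl
∈-─ (there x∈xs) (there y∈xs) y≢x = there (∈-─ x∈xs y∈xs y≢x)

count≤length : ∀ {P : Pred} {n c} (g : ℕ → ℕ) (L : List ℕ) →
               (∀ {m} → m < n → P m → ∃ λ e → e ∈ L × g e ≡ m) → Count P n c → c ≤ length L
count≤length g L covered cnt-0            = z≤n
count≤length g L covered (cnt-out _ count) = count≤length g L (λ m<n → covered (m<n⇒m<1+n m<n)) count
count≤length {P} {suc n} g L covered (cnt-in Pn count) =
  let e , e∈L , ge≡n = covered ≤-refl Pn
      covered′ : ∀ {m} → m < n → P m → ∃ λ e′ → e′ ∈ (L ─ e∈L) × g e′ ≡ m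
      covered′ m<n Pm =
        let e′ , e′∈L , ge′≡m = covered (m<n⇒m<1+n m<n) Pm
        in e′ , ∈-─ e∈L e′∈L (λ e′≡e → <-irrefl (trans (sym ge′≡m) (trans (cong g e′≡e) ge≡n)) m<n) , ge′≡m
  in ≤-trans (s≤s (count≤length g (L ─ e∈L) covered′ count)) (≤-reflexive (sym (length-removeAt′ L (index e∈L))))

count≤ : ∀ {P : Pred} {n c} (g : ℕ → ℕ) T →
         (∀ {m} → m < n → P m → ∃ λ e → e < T × g e ≡ m) → Count P n c → c ≤ T
count≤ {P} {n} g T covered count = subst (_ ≤_) (length-upTo T) (count≤length g (upTo T) covered′ count)
  where
    covered′ : ∀ {m} → m < n → P m → ∃ λ e → e ∈ upTo T × g e ≡ m
    covered′ m<n Pm = let e , e<T , ge≡m = covered m<n Pm in e , ∈-upTo⁺ e<T , ge≡m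

-- Below n, only the images of e < e₀ + K and of e with e * K < n can occur, and there are few such e.
upperDensityZero-quadraticImage : ∀ {P : Pred} (g : ℕ → ℕ) e₀ → (∀ {m} → P m → ∃ λ e → g e ≡ m) →
                                  (∀ e → e₀ ≤ e → e * e ≤ g e) → UpperDensityZero P
upperDensityZero-quadraticImage {P} g e₀ P⊆img g-quadratic k = N , density≤
  where
    K M N : ℕ
    K = suc k * 2
    M = e₀ + K
    N = suc M * K

    index-bound : ∀ {n e} → g e < n → e < M + suc (n / K)
    index-bound {n} {e} ge<n with e <? M
    ... | yes e<M = ≤-trans e<M (m≤m+n M _)
    ... | no  e≮M = ≤-trans (s≤s e≤n/K) (m≤n+m _ M)
      where
        M≤e  = ≮⇒≥ e≮M
        eK<n : e * K < n
        eK<n = ≤-<-trans (*-monoʳ-≤ e (≤-trans (m≤n+m K e₀) M≤e))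
                 (≤-<-trans (g-quadratic e (≤-trans (m≤m+n e₀ K) M≤e)) ge<n)
        e≤n/K : e ≤ n / K
        e≤n/K = subst (_≤ n / K) (m*n/n≡m e K) (/-monoˡ-≤ K (<⇒≤ eK<n))

    density≤ : ∀ n → N ≤ n → ∀ c → Count P n c → c * suc k ≤ n
    density≤ n N≤n c count = *-cancelʳ-≤ (c * suc k) n 2 (begin
      c * suc k * 2          ≡⟨ *-assoc c (suc k) 2 ⟩
      c * K                  ≤⟨ *-monoˡ-≤ K (count≤ g (M + suc (n / K)) covered count) ⟩
      (M + suc (n / K)) * K  ≡⟨ cong (_* K) (+-suc M (n / K)) ⟩
      (suc M + n / K) * K    ≡⟨ *-distribʳ-+ K (suc M) (n / K) ⟩
      N + n / K * K          ≤⟨ +-mono-≤ N≤n (m/n*n≤m n K) ⟩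
      n + n                  ≡⟨ cong (n +_) (sym (+-identityʳ n)) ⟩
      2 * n                  ≡⟨ *-comm 2 n ⟩
      n * 2                  ∎)
      where
        open ≤-Reasoning
        covered : ∀ {m} → m < n → P m → ∃ λ e → e < M + suc (n / K) × g e ≡ m
        covered m<n Pm = let e , ge≡m = P⊆img Pm in e , index-bound (subst (_< n) (sym ge≡m) m<n) , ge≡m

module Construction (em : ExcludedMiddle 0ℓ) (X : Pred) (R : ℕ → Pred) (cR : Code)
  (cR-decides : ∀ e n → (R e n → X ⊢ cR ∙ (e ∷ n ∷ []) ⇓ 1) × (¬ R e n → X ⊢ cR ∙ (e ∷ n ∷ []) ⇓ 0))
  (R-infinite : ∀ e → Infinite (R e)) where

  open PreimageSearch em X

  startC notInRC elementC : Code
  startC   = comp₁ succ (comp₂ addC (proj 0) preimageBoundC)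
  notInRC  = comp₂ monusC (constC 1) (comp₂ (relativize cR) (proj 1) (comp₂ addC (proj 2) (proj 0)))
  elementC = comp₂ addC startC (comp₂ (mu notInRC) (proj 0) startC)

  module _ {d e s : ℕ} where

    notInRC-in : R e (s + d) → O ⊢ notInRC ∙ (d ∷ e ∷ s ∷ []) ⇓ 0
    notInRC-in r = comp₂⇓ (constC⇓ 1)
      (comp₂⇓ (ev-proj refl) (comp₂⇓ (ev-proj refl) proj₀⇓ (addC⇓ s)) (relativize⇓ (proj₁ (cR-decides e (s + d)) r)))
      (monusC⇓ 1 1)

    notInRC-out : ¬ R e (s + d) → O ⊢ notInRC ∙ (d ∷ e ∷ s ∷ []) ⇓ 1
    notInRC-out ¬r = comp₂⇓ (constC⇓ 1)
      (comp₂⇓ (ev-proj refl) (comp₂⇓ (ev-proj refl) proj₀⇓ (addC⇓ s)) (relativize⇓ (proj₂ (cR-decides e (s + d)) ¬r)))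
      (monusC⇓ 1 0)

    notInRC-zero⁻¹ : O ⊢ notInRC ∙ (d ∷ e ∷ s ∷ []) ⇓ 0 → R e (s + d)
    notInRC-zero⁻¹ zero⇓ with em {R e (s + d)}
    ... | yes r = r
    ... | no ¬r = contradiction (⇓-deterministic zero⇓ (notInRC-out ¬r)) 0≢1+n

  notInRC-total : ∀ e s d → ∃ λ v → O ⊢ notInRC ∙ (d ∷ e ∷ s ∷ []) ⇓ v
  notInRC-total e s d with em {R e (s + d)}
  ... | yes r = 0 , notInRC-in r
  ... | no ¬r = 1 , notInRC-out ¬r

  record Element (e a : ℕ) : Set where
    field
      elementC⇓       : O ⊢ elementC ∙ [ e ] ⇓ a
      ∈R              : R e a
      index<          : e < a
      above-preimages : ∀ {i y b} → i ≤ e → y < e * e → O ⊢ preimageC ∙ (y ∷ i ∷ []) ⇓ b → b < a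

  opaque
    -- a_e is the least element of R_e that is at least 1 + e + Σ_{i ≤ e} Σ_{y < e²} β(y, i).
    element : ∀ e → Σ ℕ (Element e)
    element e =
      let S , bound⇓ , bound = preimageBound e
          s = suc (e + S)
          start⇓ : O ⊢ startC ∙ [ e ] ⇓ s
          start⇓ = comp₁⇓ (comp₂⇓ proj₀⇓ bound⇓ (addC⇓ e)) ev-succ
          m , s≤m , m∈R = R-infinite e s
          d , search⇓ , notInR⇓ = mu-halts (notInRC-total e s) (notInRC-in (subst (R e) (sym (m+[n∸m]≡n s≤m)) m∈R))
      in s + d , record
        { elementC⇓       = comp₂⇓ start⇓ (comp₂⇓ proj₀⇓ start⇓ search⇓) (addC⇓ s)
        ; ∈R              = notInRC-zero⁻¹ notInR⇓
        ; index<          = ≤-trans (s≤s (m≤m+n e S)) (m≤m+n s d)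
        ; above-preimages = λ i≤e y<ee b⇓ → ≤-trans (s≤s (≤-trans (bound i≤e y<ee b⇓) (m≤n+m S e))) (m≤m+n s d)
        }

  a : ℕ → ℕ
  a e = proj₁ (element e)

  open module ElementOf e = Element (proj₂ (element e))

  A : Pred
  A n = ∃ λ e → O ⊢ elementC ∙ [ e ] ⇓ n

  A-infinite : Infinite A
  A-infinite n = a n , <⇒≤ (index< n) , n , elementC⇓ n

  A-meets-R : ∀ e → ∃ λ n → A n × R e n
  A-meets-R e = a e , (e , elementC⇓ e) , ∈R e

  isElementC memberC : Code
  isElementC = comp₂ monusC (constC 1) (comp₂ distC (comp₁ elementC (proj 0)) (proj 1))
  -- n ∈ A iff n = a_e for some e ≤ n, as e < a_e.
  memberC    = comp₂ monusC (constC 1) (comp₂ monusC (constC 1)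
                 (comp₂ (sumC isElementC) (comp₁ succ (proj 0)) (proj 0)))

  isElementC⇓ : ∀ e n → O ⊢ isElementC ∙ (e ∷ n ∷ []) ⇓ (1 ∸ dist (a e) n)
  isElementC⇓ e n =
    comp₂⇓ (constC⇓ 1) (comp₂⇓ (comp₁⇓ proj₀⇓ (elementC⇓ e)) (ev-proj refl) (distC⇓ (a e) n)) (monusC⇓ 1 _)

  A-decidable : A ≤T O
  A-decidable = memberC , λ n → member n , non-member n
    where
      module Sum n = BoundedSum (boundedSum {O} {isElementC} {n} (suc n) (λ e _ → _ , isElementC⇓ e n))

      memberC⇓ : ∀ n → O ⊢ memberC ∙ [ n ] ⇓ (1 ∸ (1 ∸ Sum.value n))
      memberC⇓ n = comp₂⇓ (constC⇓ 1) (comp₂⇓ (constC⇓ 1)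
        (comp₂⇓ (comp₁⇓ proj₀⇓ ev-succ) proj₀⇓ (Sum.sumC⇓ n)) (monusC⇓ 1 _)) (monusC⇓ 1 _)

      member : ∀ n → A n → O ⊢ memberC ∙ [ n ] ⇓ 1
      member n (e , e⇓) with ⇓-deterministic (elementC⇓ e) e⇓
      ... | refl = subst (λ r → O ⊢ memberC ∙ [ n ] ⇓ r) (1∸[1∸n]≡1 1≤sum) (memberC⇓ n)
        where
          1≤sum : 1 ≤ Sum.value n
          1≤sum = Sum.summand≤ n (s≤s (<⇒≤ (index< e)))
                    (subst (λ r → O ⊢ isElementC ∙ (e ∷ n ∷ []) ⇓ (1 ∸ r)) (dist-self n) (isElementC⇓ e n))

      non-member : ∀ n → ¬ A n → O ⊢ memberC ∙ [ n ] ⇓ 0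
      non-member n ∉A = subst (λ r → O ⊢ memberC ∙ [ n ] ⇓ (1 ∸ (1 ∸ r))) sum≡0 (memberC⇓ n)
        where
          sum≡0 : Sum.value n ≡ 0
          sum≡0 = Sum.zero-summands n λ {e} _ v⇓ →
            trans (⇓-deterministic v⇓ (isElementC⇓ e n))
                  (1∸dist≡0 (λ a≡n → ∉A (e , subst (λ r → O ⊢ elementC ∙ [ e ] ⇓ r) a≡n (elementC⇓ e))))

  permutation-pushes-elements : ∀ {π c} → IsPermutation π → (∀ n → ∅ ⊢ c ∙ [ n ] ⇓ π n) →
                                ∀ e → encode c ≤ e → e * e ≤ π (a e)
  permutation-pushes-elements {π} {c} (π-injective , π-onto) c⇓ e c≤e = ≮⇒≥ λ π[aₑ]<e*e →
    let b , b⇓ = preimageC-total (π (a e)) (encode c)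
    in <⇒≢ (above-preimages e c≤e π[aₑ]<e*e b⇓) (π-injective b (a e) (preimageC-inverts c⇓ π-onto b⇓))

  A-intrinsicallySmall : IntrinsicallySmall A
  A-intrinsicallySmall = A-infinite , λ π π-permutation (c , c⇓) →
    upperDensityZero-quadraticImage (λ e → π (a e)) (encode c) (image-of-elements π)
                                    (permutation-pushes-elements π-permutation c⇓)
    where
      image-of-elements : ∀ π {m} → Img π A m → ∃ λ e → π (a e) ≡ m
      image-of-elements π (n , (e , e⇓) , πn≡m) = e , trans (cong π (⇓-deterministic (elementC⇓ e) e⇓)) πn≡m

lemma2p1 : ExcludedMiddle 0ℓ →
    (X : Pred) (R : ℕ → Pred) →
    UniformlyComputableIn X R →
    (∀ e → Infinite (R e)) →
    Σ Pred λ A → IntrinsicallySmall A × (A ≤T (∅′ ⊕ X)) × (∀ e → ∃ λ n → A n × R e n)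
lemma2p1 em X R (cR , cR-decides) R-infinite = A , A-intrinsicallySmall , A-decidable , A-meets-R
  where open Construction em X R cR cR-decides R-infinite
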